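{- Let $G$ be an interval colorable graph. Then for every $n\in\mathbb{N}$, $G[K_{2n}]$ is interval colorable, and $$w(G[K_{2n}])\le (2\,w(G)+2)n-1\quad\text{and}\quad W(G[K_{2n}])\ge (2\,W(G)+3)n-2.$$
   Context: All graphs are finite, undirected, without loops or multiple edges. $K_{2n}$ is the complete graph on $2n$ vertices. A proper edge-coloring with consecutive integers $c_1,\ldots,c_t$ is an interval $t$-coloring if all $t$ colors are used and the set of colors on edges incident to each vertex is an interval of integers. A graph is interval colorable if it has an interval $t$-coloring for some positive integer $t$; $w(G)$ and $W(G)$ denote the smallest and largest such $t$. The composition $G[H]$ has vertex set $V(G)\times V(H)$, with $(u_1,v_1)(u_2,v_2)$ an edge iff $u_1u_2\in E(G)$, or $u_1=u_2$ and $v_1v_2\in E(H)$. -}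

module Defs where

open import Data.Nat using (ℕ; zero; suc; _+_; _*_; _∸_; _≤_; _<_)
open import Data.Bool using (Bool; true; false; _∨_; _∧_; not)
open import Data.Bool.Properties using (∨-comm)
open import Data.Fin using (Fin; quotient; remainder)
open import Data.Fin.Properties using (_≟_)
open import Data.Product using (Σ; ∃; ∃-syntax; _×_; _,_)
open import Data.Empty using (⊥-elim)
open import Relation.Nullary using (¬_; yes; no)
open import Relation.Nullary.Decidable using (⌊_⌋; dec-true)
open import Relation.Binary.PropositionalEquality
  using (_≡_; _≢_; refl; sym; cong₂)

record Graph : Set where
  field
    order  : ℕ
    adj    : Fin order → Fin order → Bool
    adjSym : ∀ x y → adj x y ≡ adj y x
    adjIrr : ∀ x → adj x x ≡ false
open Graph public

Adj : (G : Graph) → Fin (order G) → Fin (order G) → Set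
Adj G x y = adj G x y ≡ true

private
  neq : ∀ {m} → Fin m → Fin m → Bool
  neq x y = not ⌊ x ≟ y ⌋

  neqIrr : ∀ {m} (x : Fin m) → neq x x ≡ false
  neqIrr x with x ≟ x
  ... | yes _ = refl
  ... | no p = ⊥-elim (p refl)

  neqSym : ∀ {m} (x y : Fin m) → neq x y ≡ neq y x
  neqSym x y with x ≟ y | y ≟ x
  ... | yes _ | yes _ = refl
  ... | no _  | no _  = refl
  ... | yes p | no q  = ⊥-elim (q (sym p))
  ... | no p  | yes q = ⊥-elim (p (sym q))

  eqb : ∀ {m} → Fin m → Fin m → Bool
  eqb x y = ⌊ x ≟ y ⌋

  eqbSym : ∀ {m} (x y : Fin m) → eqb x y ≡ eqb y x
  eqbSym x y with x ≟ y | y ≟ x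
  ... | yes _ | yes _ = refl
  ... | no _  | no _  = refl
  ... | yes p | no q  = ⊥-elim (q (sym p))
  ... | no p  | yes q = ⊥-elim (p (sym q))

K : ℕ → Graph
K m = record
  { order  = m
  ; adj    = neq
  ; adjSym = neqSym
  ; adjIrr = neqIrr
  }

-- Vertex set Fin (order G * order H), identified with Fin (order G) × Fin (order H)
-- via the bijection (quotient, remainder) of Data.Fin.
-- (u1,v1)(u2,v2) is an edge iff u1u2 ∈ E(G), or u1 = u2 and v1v2 ∈ E(H).

compose : Graph → Graph → Graph
compose G H = record
  { order  = order G * order H
  ; adj    = a
  ; adjSym = s
  ; adjIrr = i
  }
  where
  q : Fin (order G * order H) → Fin (order G)
  q = quotient (order H)
  r : Fin (order G * order H) → Fin (order H)
  r = remainder {order G} (order H)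
  a : Fin (order G * order H) → Fin (order G * order H) → Bool
  a x y = adj G (q x) (q y) ∨ (eqb (q x) (q y) ∧ adj H (r x) (r y))
  s : ∀ x y → a x y ≡ a y x
  s x y = cong₂ _∨_ (adjSym G (q x) (q y))
                    (cong₂ _∧_ (eqbSym (q x) (q y)) (adjSym H (r x) (r y)))
  i : ∀ x → a x x ≡ false
  i x rewrite adjIrr G (q x) | adjIrr H (r x)
            | Data.Bool.Properties.∧-zeroʳ (eqb (q x) (q x)) = refl

_[_] : Graph → Graph → Graph
G [ H ] = compose G H

-- An edge-coloring is given by a function c on ordered vertex pairs; only its
-- values on edges matter, and it must be symmetric on edges.

record IsIntervalColoring (G : Graph) (t : ℕ)
                          (c : Fin (order G) → Fin (order G) → ℕ) : Set where
  field
    symmetric : ∀ x y → Adj G x y → c x y ≡ c y x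
    inRange   : ∀ x y → Adj G x y → 1 ≤ c x y × c x y ≤ t
    allUsed   : ∀ k → 1 ≤ k → k ≤ t → ∃[ x ] ∃[ y ] (Adj G x y × c x y ≡ k)
    proper    : ∀ x y z → Adj G x y → Adj G x z → y ≢ z → c x y ≢ c x z
    interval  : ∀ x → ∃[ lo ] ∃[ hi ]
                  (∀ k → ((lo ≤ k × k ≤ hi) → ∃[ y ] (Adj G x y × c x y ≡ k))
                       × (∀ y → Adj G x y → c x y ≡ k → lo ≤ k × k ≤ hi))

HasIntervalColoring : Graph → ℕ → Set
HasIntervalColoring G t = ∃[ c ] IsIntervalColoring G t c

IntervalColorable : Graph → Set
IntervalColorable G = ∃[ t ] (1 ≤ t × HasIntervalColoring G t)

IsW : Graph → ℕ → Set
IsW G t = (1 ≤ t × HasIntervalColoring G t)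
        × (∀ t′ → 1 ≤ t′ → HasIntervalColoring G t′ → t ≤ t′)

IsWmax : Graph → ℕ → Set
IsWmax G t = (1 ≤ t × HasIntervalColoring G t)
           × (∀ t′ → 1 ≤ t′ → HasIntervalColoring G t′ → t′ ≤ t)

module Submission where

-- Let c be an interval t-coloring of G, n ≥ 1, N = 2n and M = 2n − 1.  A vertex of
-- G[K_N] is a pair (u, i) with u ∈ V(G) and i < N.  We colour
--   * an external edge (u,i)(v,j), uv ∈ E(G), by  c(uv)·N + ((i + j) mod N);
--     as j ↦ (i + j) mod N is a bijection (cyclic Latin square), the external colours
--     at (u,i) are exactly the interval [lo·N, hi·N + M], where [lo, hi] is the colour
--     interval of u in c;
--   * an internal edge (u,i)(u,j) by  β(u) + 1 + φ(i,j), where φ is the round-robin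
--     1-factorisation of K_N with the M colours 0 … M−1, and the offset β(u) puts these
--     M colours either directly below (β = (lo−1)·N) or directly above (β = hi·N + M)
--     the external interval, so the colours at (u,i) still form an interval.
-- Putting every block below gives an interval (tN + M)-coloring, hence
-- w(G[K_2n]) ≤ (2w+2)n − 1.  Putting it below only at an end of a colour-1 edge and
-- above everywhere else gives an interval (tN + 2M)-coloring, hence
-- W(G[K_2n]) ≥ (2W+4)n − 2 ≥ (2W+3)n − 2.
-- The file develops modular arithmetic, the two finite colourings of K_N, the
-- coordinates of G[K_N], the coloring above with its properties, and then theorem7.

open import Defs
open import Data.Nat
open import Data.Nat.Properties
open import Data.Nat.DivMod
open import Data.Nat.Tactic.RingSolver using (solve-∀)
open import Data.Bool using (Bool; true; false)
open import Data.Bool.Properties using (∨-zeroʳ) renaming (_≟_ to _≟B_)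
open import Data.Fin using (Fin; toℕ; fromℕ<; quotient; remainder; combine)
open import Data.Fin.Properties
  using (any?; toℕ-fromℕ<; toℕ-injective; toℕ<n; remQuot-combine; combine-remQuot)
  renaming (_≟_ to _≟F_)
open import Data.Product using (∃-syntax; _×_; _,_; proj₁; proj₂)
open import Data.Sum using (_⊎_; inj₁; inj₂)
open import Data.Empty using (⊥-elim)
open import Relation.Nullary using (¬_; yes; no; Dec; does)
open import Relation.Nullary.Decidable using (dec-true; dec-false)
open import Relation.Binary.PropositionalEquality hiding ([_])

%-absorb-+ʳ : ∀ m n d .{{_ : NonZero d}} → (m + n % d) % d ≡ (m + n) % d
%-absorb-+ʳ m n d = begin
  (m + n % d) % d         ≡⟨ %-distribˡ-+ m (n % d) d ⟩
  (m % d + n % d % d) % d ≡⟨ cong (λ z → (m % d + z) % d) (m%n%n≡m%n n d) ⟩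
  (m % d + n % d) % d     ≡⟨ %-distribˡ-+ m n d ⟨
  (m + n) % d             ∎
  where open ≡-Reasoning

%-absorb-+ˡ : ∀ m n d .{{_ : NonZero d}} → (m % d + n) % d ≡ (m + n) % d
%-absorb-+ˡ m n d = begin
  (m % d + n) % d ≡⟨ cong (_% d) (+-comm (m % d) n) ⟩
  (n + m % d) % d ≡⟨ %-absorb-+ʳ n m d ⟩
  (n + m) % d     ≡⟨ cong (_% d) (+-comm n m) ⟩
  (m + n) % d     ∎
  where open ≡-Reasoning

%-absorb-*ˡ : ∀ m n d .{{_ : NonZero d}} → ((m % d) * n) % d ≡ (m * n) % d
%-absorb-*ˡ m n d = begin
  ((m % d) * n) % d           ≡⟨ %-distribˡ-* (m % d) n d ⟩
  ((m % d % d) * (n % d)) % d ≡⟨ cong (λ z → (z * (n % d)) % d) (m%n%n≡m%n m d) ⟩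
  ((m % d) * (n % d)) % d     ≡⟨ %-distribˡ-* m n d ⟨
  (m * n) % d                 ∎
  where open ≡-Reasoning

-- Base-d digits are unique: a + c·d = b + e·d with a, b < d forces a = b and c = e.
-- This is what separates the external colours c(uv)·N + L(i,j) of different edges.
digits-unique : ∀ d .{{_ : NonZero d}} a b c e → a < d → b < d →
                a + c * d ≡ b + e * d → a ≡ b × c ≡ e
digits-unique d a b c e a<d b<d eq =
  a≡b , *-cancelʳ-≡ c e d (+-cancelˡ-≡ a _ _ (trans eq (cong (_+ e * d) (sym a≡b))))
  where
  open ≡-Reasoning
  a≡b : a ≡ b
  a≡b = begin
    a               ≡⟨ m<n⇒m%n≡m a<d ⟨
    a % d           ≡⟨ [m+kn]%n≡m%n a c d ⟨
    (a + c * d) % d ≡⟨ cong (_% d) eq ⟩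
    (b + e * d) % d ≡⟨ [m+kn]%n≡m%n b e d ⟩
    b % d           ≡⟨ m<n⇒m%n≡m b<d ⟩
    b               ∎

module CyclicLatinSquare (N : ℕ) .{{_ : NonZero N}} where

  L : ℕ → ℕ → ℕ
  L i j = (i + j) % N

  column : ℕ → ℕ → ℕ
  column i a = (a + (N ∸ i)) % N

  L-sym : ∀ i j → L i j ≡ L j i
  L-sym i j = cong (_% N) (+-comm i j)

  L< : ∀ i j → L i j < N
  L< i j = m%n<n (i + j) N

  column< : ∀ i a → column i a < N
  column< i a = m%n<n (a + (N ∸ i)) N

  cancel : ∀ i a → i ≤ N → a < N → (i + (a + (N ∸ i))) % N ≡ a
  cancel i a i≤N a<N = begin
    (i + (a + (N ∸ i))) % N ≡⟨ cong (_% N) (+-assoc i a (N ∸ i)) ⟨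
    (i + a + (N ∸ i)) % N   ≡⟨ cong (λ z → (z + (N ∸ i)) % N) (+-comm i a) ⟩
    (a + i + (N ∸ i)) % N   ≡⟨ cong (_% N) (+-assoc a i (N ∸ i)) ⟩
    (a + (i + (N ∸ i))) % N ≡⟨ cong (λ z → (a + z) % N) (m+[n∸m]≡n i≤N) ⟩
    (a + N) % N             ≡⟨ [m+n]%n≡m%n a N ⟩
    a % N                   ≡⟨ m<n⇒m%n≡m a<N ⟩
    a                       ∎
    where open ≡-Reasoning

  L-column : ∀ i a → i ≤ N → a < N → L i (column i a) ≡ a
  L-column i a i≤N a<N =
    trans (%-absorb-+ʳ i (a + (N ∸ i)) N) (cancel i a i≤N a<N)

  column-L : ∀ i j → i ≤ N → j < N → column i (L i j) ≡ j
  column-L i j i≤N j<N = begin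
    ((i + j) % N + (N ∸ i)) % N ≡⟨ %-absorb-+ˡ (i + j) (N ∸ i) N ⟩
    (i + j + (N ∸ i)) % N       ≡⟨ cong (_% N) (+-assoc i j (N ∸ i)) ⟩
    (i + (j + (N ∸ i))) % N     ≡⟨ cancel i j i≤N j<N ⟩
    j                           ∎
    where open ≡-Reasoning

  L-injective : ∀ i j j′ → i ≤ N → j < N → j′ < N → L i j ≡ L i j′ → j ≡ j′
  L-injective i j j′ i≤N j<N j′<N eq = begin
    j               ≡⟨ column-L i j i≤N j<N ⟨
    column i (L i j)  ≡⟨ cong (column i) eq ⟩
    column i (L i j′) ≡⟨ column-L i j′ i≤N j′<N ⟩
    j′              ∎
    where open ≡-Reasoning

-- 2(n′ + 1) = M + 1 for M = 2n′ + 1, i.e. n′ + 1 is the inverse of 2 modulo M.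
double-factor : ∀ a n′ → a * suc n′ + a * suc n′ ≡ a + a * suc (n′ + n′)
double-factor = solve-∀

-- The round-robin 1-factorisation φ of K_{2n}, n = n′ + 1, on the vertices 0,…,M,
-- where M = 2n − 1 plays the rôle of ∞: the edge ij (i, j < M) gets colour
-- (i + j) mod M and the edge i∞ gets colour 2i mod M.
module RoundRobin (n′ : ℕ) where

  M : ℕ
  M = suc (n′ + n′)

  open CyclicLatinSquare M

  finite : ℕ → ℕ → ℕ
  finite i j with j ≟ M
  ... | yes _ = i
  ... | no _  = j

  finite-∞ : ∀ i → finite i M ≡ i
  finite-∞ i with M ≟ M
  ... | yes _  = refl
  ... | no M≢M = ⊥-elim (M≢M refl)

  finite-fin : ∀ i j → j ≢ M → finite i j ≡ j
  finite-fin i j j≢M with j ≟ M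
  ... | yes j≡M = ⊥-elim (j≢M j≡M)
  ... | no _    = refl

  finite< : ∀ i j → i < M → j ≤ M → finite i j < M
  finite< i j i<M j≤M with j ≟ M
  ... | yes _   = i<M
  ... | no j≢M  = ≤∧≢⇒< j≤M j≢M

  finite-injective : ∀ i j j′ → j ≢ i → j′ ≢ i → finite i j ≡ finite i j′ → j ≡ j′
  finite-injective i j j′ j≢i j′≢i eq with j ≟ M | j′ ≟ M
  ... | yes j≡M | yes j′≡M = trans j≡M (sym j′≡M)
  ... | yes _   | no _     = ⊥-elim (j′≢i (sym eq))
  ... | no _    | yes _    = ⊥-elim (j≢i eq)
  ... | no _    | no _     = eq

  φ : ℕ → ℕ → ℕ
  φ i j = (finite j i + finite i j) % M

  φ-sym : ∀ i j → φ i j ≡ φ j i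
  φ-sym i j = cong (_% M) (+-comm (finite j i) (finite i j))

  φ< : ∀ i j → φ i j < M
  φ< i j = m%n<n (finite j i + finite i j) M

  φ-∞ : ∀ j → j ≢ M → φ M j ≡ (j + j) % M
  φ-∞ j j≢M = cong (_% M) (cong₂ _+_ (finite-∞ j) (finite-fin M j j≢M))

  φ-fin : ∀ i j → i ≢ M → φ i j ≡ L i (finite i j)
  φ-fin i j i≢M = cong (λ z → (z + finite i j) % M) (finite-fin j i i≢M)

  halve : ℕ → ℕ
  halve a = (a * suc n′) % M

  halve< : ∀ a → halve a < M
  halve< a = m%n<n (a * suc n′) M

  double-halve-factor : ∀ a → (a * suc n′ + a * suc n′) % M ≡ a % M
  double-halve-factor a = trans (cong (_% M) (double-factor a n′)) ([m+kn]%n≡m%n a a M)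

  double-halve : ∀ a → a < M → (halve a + halve a) % M ≡ a
  double-halve a a<M = begin
    (halve a + halve a) % M           ≡⟨ %-absorb-+ˡ (a * suc n′) (halve a) M ⟩
    (a * suc n′ + halve a) % M        ≡⟨ %-absorb-+ʳ (a * suc n′) (a * suc n′) M ⟩
    (a * suc n′ + a * suc n′) % M     ≡⟨ double-halve-factor a ⟩
    a % M                             ≡⟨ m<n⇒m%n≡m a<M ⟩
    a                                 ∎
    where open ≡-Reasoning

  halve-double : ∀ j → j < M → halve ((j + j) % M) ≡ j
  halve-double j j<M = begin
    (((j + j) % M) * suc n′) % M  ≡⟨ %-absorb-*ˡ (j + j) (suc n′) M ⟩
    ((j + j) * suc n′) % M        ≡⟨ cong (_% M) (*-distribʳ-+ (suc n′) j j) ⟩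
    (j * suc n′ + j * suc n′) % M ≡⟨ double-halve-factor j ⟩
    j % M                         ≡⟨ m<n⇒m%n≡m j<M ⟩
    j                             ∎
    where open ≡-Reasoning

  -- Row ∞: doubling modulo M is injective, being inverted by halving.
  φ-injective-∞ : ∀ j j′ → j < M → j′ < M → φ M j ≡ φ M j′ → j ≡ j′
  φ-injective-∞ j j′ j<M j′<M eq = begin
    j                     ≡⟨ halve-double j j<M ⟨
    halve ((j + j) % M)   ≡⟨ cong halve (trans (sym (φ-∞ j (<⇒≢ j<M))) (trans eq (φ-∞ j′ (<⇒≢ j′<M)))) ⟩
    halve ((j′ + j′) % M) ≡⟨ halve-double j′ j′<M ⟩
    j′                    ∎
    where open ≡-Reasoning

  -- A finite row i is injective off the diagonal: a row of the Latin square,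
  -- composed with the replacement of ∞ by i.
  φ-injective-fin : ∀ i j j′ → i < M → j ≤ M → j′ ≤ M → j ≢ i → j′ ≢ i →
                    φ i j ≡ φ i j′ → j ≡ j′
  φ-injective-fin i j j′ i<M j≤M j′≤M j≢i j′≢i eq = finite-injective i j j′ j≢i j′≢i
    (L-injective i (finite i j) (finite i j′) (<⇒≤ i<M)
      (finite< i j i<M j≤M) (finite< i j′ i<M j′≤M)
      (trans (sym (φ-fin i j (<⇒≢ i<M))) (trans eq (φ-fin i j′ (<⇒≢ i<M)))))

  φ-injective : ∀ i j j′ → i ≤ M → j ≤ M → j′ ≤ M → j ≢ i → j′ ≢ i →
                φ i j ≡ φ i j′ → j ≡ j′
  φ-injective i j j′ i≤M j≤M j′≤M j≢i j′≢i = byRow (i ≟ M)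
    where
    byRow : Dec (i ≡ M) → φ i j ≡ φ i j′ → j ≡ j′
    byRow (yes refl) = φ-injective-∞ j j′ (≤∧≢⇒< j≤M j≢i) (≤∧≢⇒< j′≤M j′≢i)
    byRow (no i≢M)   = φ-injective-fin i j j′ (≤∧≢⇒< i≤M i≢M) j≤M j′≤M j≢i j′≢i

  -- Row ∞ attains a at halve a; a finite row i attains a at the column of the
  -- Latin square, or at ∞ if that column is i itself.
  φ-surjective : ∀ i a → i ≤ M → a < M → ∃[ j ] (j ≤ M × j ≢ i × φ i j ≡ a)
  φ-surjective i a i≤M a<M = byRow (i ≟ M)
    where
    open ≡-Reasoning
    byRow : Dec (i ≡ M) → ∃[ j ] (j ≤ M × j ≢ i × φ i j ≡ a)
    byRow (yes refl) = halve a , <⇒≤ (halve< a) , <⇒≢ (halve< a) ,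
                       trans (φ-∞ (halve a) (<⇒≢ (halve< a))) (double-halve a a<M)
    byRow (no i≢M) = byColumn (column i a ≟ i)
      where
      byColumn : Dec (column i a ≡ i) → ∃[ j ] (j ≤ M × j ≢ i × φ i j ≡ a)
      byColumn (yes col≡i) = M , ≤-refl , (λ M≡i → i≢M (sym M≡i)) , (begin
        φ i M             ≡⟨ φ-fin i M i≢M ⟩
        L i (finite i M)  ≡⟨ cong (L i) (trans (finite-∞ i) (sym col≡i)) ⟩
        L i (column i a)  ≡⟨ L-column i a i≤M a<M ⟩
        a                 ∎)
      byColumn (no col≢i) = column i a , <⇒≤ (column< i a) , col≢i , (begin
        φ i (column i a)            ≡⟨ φ-fin i (column i a) i≢M ⟩
        L i (finite i (column i a)) ≡⟨ cong (L i) (finite-fin i (column i a) (<⇒≢ (column< i a))) ⟩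
        L i (column i a)            ≡⟨ L-column i a i≤M a<M ⟩
        a                           ∎)

adj⇒≢ : (G : Graph) → ∀ {u v} → Adj G u v → u ≢ v
adj⇒≢ G {u} uv refl with trans (sym uv) (adjIrr G u)
... | ()

record Exactly (G : Graph) (c : Fin (order G) → Fin (order G) → ℕ)
               (x : Fin (order G)) (lo hi : ℕ) : Set where
  field
    realised : ∀ k → lo ≤ k → k ≤ hi → ∃[ y ] (Adj G x y × c x y ≡ k)
    bounded  : ∀ y → Adj G x y → lo ≤ c x y × c x y ≤ hi

exactly⇒interval : ∀ {G c x lo hi} → Exactly G c x lo hi →
  ∀ k → ((lo ≤ k × k ≤ hi) → ∃[ y ] (Adj G x y × c x y ≡ k))
      × (∀ y → Adj G x y → c x y ≡ k → lo ≤ k × k ≤ hi)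
exactly⇒interval ex k =
  (λ (l , h) → Exactly.realised ex k l h) ,
  (λ { y xy refl → Exactly.bounded ex y xy })

interval⇒exactly : ∀ {G c x lo hi} →
  (∀ k → ((lo ≤ k × k ≤ hi) → ∃[ y ] (Adj G x y × c x y ≡ k))
       × (∀ y → Adj G x y → c x y ≡ k → lo ≤ k × k ≤ hi)) →
  Exactly G c x lo hi
interval⇒exactly {c = c} f = record
  { realised = λ k l h → proj₁ (f k) (l , h)
  ; bounded  = λ y xy → proj₂ (f (c _ y)) y xy refl
  }

module Coordinates (G : Graph) (N : ℕ) where

  V : Set
  V = Fin (order G)

  H : Graph
  H = G [ K N ]

  X : Set
  X = Fin (order G * N)

  block : X → V
  block = quotient N

  index : X → Fin N
  index = remainder {order G} N

  pos : X → ℕ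
  pos x = toℕ (index x)

  pos< : ∀ x → pos x < N
  pos< x = toℕ<n (index x)

  pair : V → ∀ j → j < N → X
  pair u j j<N = combine u (fromℕ< j<N)

  block-pair : ∀ u j j<N → block (pair u j j<N) ≡ u
  block-pair u j j<N = cong proj₁ (remQuot-combine u (fromℕ< j<N))

  pos-pair : ∀ u j j<N → pos (pair u j j<N) ≡ j
  pos-pair u j j<N =
    trans (cong (λ q → toℕ (proj₂ q)) (remQuot-combine u (fromℕ< j<N))) (toℕ-fromℕ< j<N)

  coordinates-injective : ∀ y z → block y ≡ block z → pos y ≡ pos z → y ≡ z
  coordinates-injective y z same-block same-pos = begin
    y                          ≡⟨ combine-remQuot {order G} N y ⟨
    combine (block y) (index y) ≡⟨ cong₂ combine same-block (toℕ-injective same-pos) ⟩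
    combine (block z) (index z) ≡⟨ combine-remQuot {order G} N z ⟩
    z                          ∎
    where open ≡-Reasoning

  adjacent-split : ∀ x y → Adj H x y →
    Adj G (block x) (block y) ⊎ (block x ≡ block y × index x ≢ index y)
  adjacent-split x y xy with adj G (block x) (block y) | block x ≟F block y | index x ≟F index y
  ... | true  | _        | _         = inj₁ refl
  ... | false | yes same | no differ = inj₂ (same , differ)
  adjacent-split x y () | false | yes _ | yes _
  adjacent-split x y () | false | no _  | _

  adjacent-external : ∀ x y → Adj G (block x) (block y) → Adj H x y
  adjacent-external x y uv rewrite uv = refl

  adjacent-internal : ∀ x y → block x ≡ block y → index x ≢ index y → Adj H x y
  adjacent-internal x y same differ with block x ≟F block y | index x ≟F index y
  ... | no different | _        = ⊥-elim (different same)
  ... | yes _        | yes eq   = ⊥-elim (differ eq)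
  ... | yes _        | no _     = ∨-zeroʳ (adj G (block x) (block y))

module LocalSpans {G : Graph} {t : ℕ} {c : Fin (order G) → Fin (order G) → ℕ}
                  (IC : IsIntervalColoring G t c) where

  private module IC = IsIntervalColoring IC

  data Span (u : Fin (order G)) : Set where
    isolated : (∀ v → ¬ Adj G u v) → Span u
    spans    : (p h : ℕ) → suc p ≤ h → h ≤ t → Exactly G c u (suc p) h → Span u

  -- At a vertex with an incident edge the interval [lo, hi] provided by c is
  -- nonempty and, consisting of used colours, lies inside [1, t].
  spanAt : ∀ u v → Adj G u v → ∀ lo hi → Exactly G c u lo hi → Span u
  spanAt u v uv lo hi ex with Exactly.bounded ex v uv
  ... | lo≤c , c≤hi = fromLo lo ex (≤-trans lo≤c c≤hi)
    where
    used : ∀ {l} → Exactly G c u l hi → ∀ k → l ≤ k → k ≤ hi → 1 ≤ k × k ≤ t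
    used ex′ k l≤k k≤hi with Exactly.realised ex′ k l≤k k≤hi
    ... | w , uw , refl = IC.inRange u w uw
    fromLo : ∀ l → Exactly G c u l hi → l ≤ hi → Span u
    fromLo zero    ex′ 0≤hi = ⊥-elim (1+n≰n (proj₁ (used ex′ 0 ≤-refl 0≤hi)))
    fromLo (suc p) ex′ l≤hi = spans p hi l≤hi (proj₂ (used ex′ hi l≤hi ≤-refl)) ex′

  span : ∀ u → Span u
  span u with any? (λ v → adj G u v ≟B true)
  ... | no  none     = isolated (λ v uv → none (v , uv))
  ... | yes (v , uv) with IC.interval u
  ...   | lo , hi , f = spanAt u v uv lo hi (interval⇒exactly f)

-- The coloring of G[K_N], N = 2(n′+1), built from an interval t-coloring c of G, where
-- `below u` says whether the M internal colours of the block over u are put directly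
-- below or directly above its external colours.
module Lift {G : Graph} {t : ℕ} {c : Fin (order G) → Fin (order G) → ℕ}
            (IC : IsIntervalColoring G t c) (n′ : ℕ) (below : Fin (order G) → Bool) where

  open RoundRobin n′ using (M; φ; φ<; φ-sym; φ-injective; φ-surjective)

  N : ℕ
  N = suc M

  open CyclicLatinSquare N using (L; L<; L-sym; column; column<; L-column; L-injective)
  open Coordinates G N
  open LocalSpans IC
  private module IC = IsIntervalColoring IC

  -- β(u): the internal colours over u are β(u)+1, …, β(u)+M.  If the colours of c at u
  -- are p+1, …, h, the external ones are (p+1)N, …, M + hN, and β(u) = pN resp. M + hN
  -- places the internal colours right next to them.
  offset : ∀ {u} → Span u → Bool → ℕ
  offset (isolated _)      _     = 0
  offset (spans p h _ _ _) true  = p * N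
  offset (spans p h _ _ _) false = M + h * N

  β : V → ℕ
  β u = offset (span u) (below u)

  colour : X → X → ℕ
  colour x y with block x ≟F block y
  ... | yes _ = β (block x) + suc (φ (pos x) (pos y))
  ... | no _  = L (pos x) (pos y) + c (block x) (block y) * N

  colour-internal : ∀ x y → block x ≡ block y →
                    colour x y ≡ β (block x) + suc (φ (pos x) (pos y))
  colour-internal x y same with block x ≟F block y
  ... | yes _        = refl
  ... | no different = ⊥-elim (different same)

  colour-external : ∀ x y → block x ≢ block y →
                    colour x y ≡ L (pos x) (pos y) + c (block x) (block y) * N
  colour-external x y different with block x ≟F block y
  ... | yes same = ⊥-elim (different same)
  ... | no _     = refl

  pos≤M : ∀ x → pos x ≤ M
  pos≤M x = ≤-pred (pos< x)

  internal-digit : ∀ B k → B < k → k ≤ B + M → ∃[ d ] (d < M × B + suc d ≡ k)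
  internal-digit B k B<k k≤B+M with m≤n⇒∃[o]m+o≡n B<k
  ... | d , eq = d , +-cancelˡ-< B d M (≤-trans (≤-reflexive eq) k≤B+M) , B+1+d≡k
    where
    B+1+d≡k : B + suc d ≡ k
    B+1+d≡k = trans (+-suc B d) eq

  internal-range : ∀ x y → block x ≡ block y →
                   suc (β (block x)) ≤ colour x y × colour x y ≤ β (block x) + M
  internal-range x y same rewrite colour-internal x y same =
    subst (suc b ≤_) (sym (+-suc b f)) (s≤s (m≤m+n b f)) , +-monoʳ-≤ b (φ< (pos x) (pos y))
    where
    b = β (block x)
    f = φ (pos x) (pos y)

  internal-realised : ∀ x k → β (block x) < k → k ≤ β (block x) + M →
                      ∃[ y ] (Adj H x y × colour x y ≡ k)
  internal-realised x k β<k k≤β+M with internal-digit (β (block x)) k β<k k≤β+M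
  ... | a , a<M , β+1+a≡k with φ-surjective (pos x) a (pos≤M x) a<M
  ...   | j , j≤M , j≢pos , φ≡a =
    y , adjacent-internal x y (sym same) differ , (begin
      colour x y                            ≡⟨ colour-internal x y (sym same) ⟩
      β (block x) + suc (φ (pos x) (pos y)) ≡⟨ cong (λ i → β (block x) + suc (φ (pos x) i)) pos-y ⟩
      β (block x) + suc (φ (pos x) j)       ≡⟨ cong (λ e → β (block x) + suc e) φ≡a ⟩
      β (block x) + suc a                   ≡⟨ β+1+a≡k ⟩
      k                                     ∎)
    where
    open ≡-Reasoning
    y : X
    y = pair (block x) j (s≤s j≤M)
    same : block y ≡ block x
    same = block-pair (block x) j (s≤s j≤M)
    pos-y : pos y ≡ j
    pos-y = pos-pair (block x) j (s≤s j≤M)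
    differ : index x ≢ index y
    differ eq = j≢pos (trans (sym pos-y) (sym (cong toℕ eq)))

  -- If the colours of c at u = block x are p+1, …, h, the external colours at x are
  -- exactly (p+1)N, …, M + hN: the colour c(uv)·N + L(i,j) has c(uv) as leading
  -- base-N digit, and row i of L takes every value.
  external-range : ∀ x y {p h} → Exactly G c (block x) (suc p) h → Adj G (block x) (block y) →
                   suc p * N ≤ colour x y × colour x y ≤ M + h * N
  external-range x y ex uv rewrite colour-external x y (adj⇒≢ G uv) =
    ≤-trans (*-monoˡ-≤ N lo≤c) (m≤n+m _ _) ,
    +-mono-≤ (≤-pred (L< (pos x) (pos y))) (*-monoˡ-≤ N c≤h)
    where
    lo≤c = proj₁ (Exactly.bounded ex (block y) uv)
    c≤h  = proj₂ (Exactly.bounded ex (block y) uv)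

  leading-digit : ∀ p h k → suc p * N ≤ k → k ≤ M + h * N → suc p ≤ k / N × k / N ≤ h
  leading-digit p h k lo≤k k≤hi =
    subst (_≤ k / N) (m*n/n≡m (suc p) N) (/-monoˡ-≤ N lo≤k) ,
    ≤-pred (m<n*o⇒m/o<n {k} {suc h} {N} (s≤s k≤hi))

  external-realised : ∀ x {p h} → Exactly G c (block x) (suc p) h →
                      ∀ k → suc p * N ≤ k → k ≤ M + h * N → ∃[ y ] (Adj H x y × colour x y ≡ k)
  external-realised x {p} {h} ex k lo≤k k≤hi
    with Exactly.realised ex (k / N) (proj₁ (leading-digit p h k lo≤k k≤hi))
                                     (proj₂ (leading-digit p h k lo≤k k≤hi))
  ... | v , uv , c≡k/N = y , adjacent-external x y (subst (Adj G (block x)) (sym same) uv) , (begin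
      colour x y                                     ≡⟨ colour-external x y (λ eq → adj⇒≢ G uv (trans eq same)) ⟩
      L (pos x) (pos y) + c (block x) (block y) * N  ≡⟨ cong₂ (λ i w → L (pos x) i + c (block x) w * N) pos-y same ⟩
      L (pos x) j + c (block x) v * N                ≡⟨ cong₂ (λ i e → i + e * N) (L-column (pos x) (k % N) (<⇒≤ (pos< x)) (m%n<n k N)) c≡k/N ⟩
      k % N + (k / N) * N                            ≡⟨ m≡m%n+[m/n]*n k N ⟨
      k                                              ∎)
    where
    open ≡-Reasoning
    j = column (pos x) (k % N)
    y : X
    y = pair v j (column< (pos x) (k % N))
    same : block y ≡ v
    same = block-pair v j (column< (pos x) (k % N))
    pos-y : pos y ≡ j
    pos-y = pos-pair v j (column< (pos x) (k % N))

  interval-isolated : ∀ x → (∀ v → ¬ Adj G (block x) v) → β (block x) ≡ 0 →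
                      Exactly H colour x 1 M
  interval-isolated x iso β≡0 = record { realised = realised ; bounded = bounded }
    where
    realised : ∀ k → 1 ≤ k → k ≤ M → ∃[ y ] (Adj H x y × colour x y ≡ k)
    realised k 1≤k k≤M =
      internal-realised x k (subst (_< k) (sym β≡0) 1≤k) (subst (λ b → k ≤ b + M) (sym β≡0) k≤M)
    bounded : ∀ y → Adj H x y → 1 ≤ colour x y × colour x y ≤ M
    bounded y xy with adjacent-split x y xy
    ... | inj₁ uv          = ⊥-elim (iso _ uv)
    ... | inj₂ (same , _) =
      subst (λ b → suc b ≤ colour x y × colour x y ≤ b + M) β≡0 (internal-range x y same)

  interval-below : ∀ x {p h} → Exactly G c (block x) (suc p) h → suc p ≤ h → β (block x) ≡ p * N →
                   Exactly H colour x (suc (p * N)) (M + h * N)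
  interval-below x {p} {h} ex p<h β≡pN = record { realised = realised ; bounded = bounded }
    where
    top-internal≤top : p * N + M ≤ M + h * N
    top-internal≤top = ≤-trans (≤-reflexive (+-comm (p * N) M)) (+-monoʳ-≤ M (*-monoˡ-≤ N (<⇒≤ p<h)))
    realised : ∀ k → suc (p * N) ≤ k → k ≤ M + h * N → ∃[ y ] (Adj H x y × colour x y ≡ k)
    realised k lo≤k k≤hi with k ≤? p * N + M
    ... | yes k≤top = internal-realised x k (subst (_< k) (sym β≡pN) lo≤k)
                                            (subst (λ b → k ≤ b + M) (sym β≡pN) k≤top)
    ... | no  k≰top = external-realised x ex k
                        (subst (_≤ k) (cong suc (+-comm (p * N) M)) (≰⇒> k≰top)) k≤hi
    bounded : ∀ y → Adj H x y → suc (p * N) ≤ colour x y × colour x y ≤ M + h * N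
    bounded y xy with adjacent-split x y xy
    ... | inj₁ uv with external-range x y ex uv
    ...   | lo≤col , col≤hi = ≤-trans (s≤s (m≤n+m (p * N) M)) lo≤col , col≤hi
    bounded y xy | inj₂ (same , _) with internal-range x y same
    ...   | lo≤col , col≤top rewrite β≡pN = lo≤col , ≤-trans col≤top top-internal≤top

  interval-above : ∀ x {p h} → Exactly G c (block x) (suc p) h → suc p ≤ h → β (block x) ≡ M + h * N →
                   Exactly H colour x (suc p * N) (M + h * N + M)
  interval-above x {p} {h} ex p<h β≡top = record { realised = realised ; bounded = bounded }
    where
    realised : ∀ k → suc p * N ≤ k → k ≤ M + h * N + M → ∃[ y ] (Adj H x y × colour x y ≡ k)
    realised k lo≤k k≤hi with k ≤? M + h * N
    ... | yes k≤top = external-realised x ex k lo≤k k≤top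
    ... | no  k≰top = internal-realised x k (subst (_< k) (sym β≡top) (≰⇒> k≰top))
                                            (subst (λ b → k ≤ b + M) (sym β≡top) k≤hi)
    bounded : ∀ y → Adj H x y → suc p * N ≤ colour x y × colour x y ≤ M + h * N + M
    bounded y xy with adjacent-split x y xy
    ... | inj₁ uv with external-range x y ex uv
    ...   | lo≤col , col≤top = lo≤col , ≤-trans col≤top (m≤m+n (M + h * N) M)
    bounded y xy | inj₂ (same , _) with internal-range x y same
    ...   | lo≤col , col≤hi rewrite β≡top =
      ≤-trans (s≤s (+-monoʳ-≤ M (*-monoˡ-≤ N (<⇒≤ p<h)))) lo≤col , col≤hi

  interval-at : ∀ x → ∃[ lo ] ∃[ hi ] Exactly H colour x lo hi
  interval-at x with span (block x) in span≡ | below (block x) in below≡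
  ... | isolated iso         | _     = 1 , M , interval-isolated x iso (cong₂ offset span≡ below≡)
  ... | spans p h p<h _ ex   | true  = _ , _ , interval-below x ex p<h (cong₂ offset span≡ below≡)
  ... | spans p h p<h _ ex   | false = _ , _ , interval-above x ex p<h (cong₂ offset span≡ below≡)

  -- At each vertex the internal colours lie strictly below or strictly above all
  -- external ones, so an internal and an external edge never share a colour.
  internal≢external : ∀ x y z → block x ≡ block y → Adj G (block x) (block z) →
                      colour x y ≢ colour x z
  internal≢external x y z same uz with span (block x) in span≡ | below (block x) in below≡
  ... | isolated iso       | _     = ⊥-elim (iso _ uz)
  ... | spans p h _ _ ex   | true  = <⇒≢ (begin-strict
    colour x y    ≤⟨ proj₂ (internal-range x y same) ⟩
    β (block x) + M ≡⟨ cong (_+ M) (cong₂ offset span≡ below≡) ⟩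
    p * N + M     ≡⟨ +-comm (p * N) M ⟩
    M + p * N     <⟨ ≤-refl ⟩
    suc p * N     ≤⟨ proj₁ (external-range x z ex uz) ⟩
    colour x z    ∎)
    where open ≤-Reasoning
  ... | spans p h _ _ ex   | false = ≢-sym (<⇒≢ (begin-strict
    colour x z    ≤⟨ proj₂ (external-range x z ex uz) ⟩
    M + h * N     ≡⟨ cong₂ offset span≡ below≡ ⟨
    β (block x)   <⟨ proj₁ (internal-range x y same) ⟩
    colour x y    ∎))
    where open ≤-Reasoning

  internal-proper : ∀ x y z → block x ≡ block y → block x ≡ block z →
                    index x ≢ index y → index x ≢ index z → colour x y ≡ colour x z → y ≡ z
  internal-proper x y z same-y same-z differ-y differ-z eq =
    coordinates-injective y z (trans (sym same-y) same-z)
      (φ-injective (pos x) (pos y) (pos z) (pos≤M x) (pos≤M y) (pos≤M z)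
        (λ e → differ-y (toℕ-injective (sym e))) (λ e → differ-z (toℕ-injective (sym e)))
        (suc-injective (+-cancelˡ-≡ (β (block x)) _ _
          (trans (sym (colour-internal x y same-y)) (trans eq (colour-internal x z same-z))))))

  -- External edges at x of equal colour have the same leading digit c(uv), hence the
  -- same block (c is proper), and the same last digit L(i,j), hence the same index.
  external-proper : ∀ x y z → Adj G (block x) (block y) → Adj G (block x) (block z) →
                    colour x y ≡ colour x z → y ≡ z
  external-proper x y z uy uz eq
    with digits-unique N (L (pos x) (pos y)) (L (pos x) (pos z))
           (c (block x) (block y)) (c (block x) (block z))
           (L< (pos x) (pos y)) (L< (pos x) (pos z))
           (trans (sym (colour-external x y (adj⇒≢ G uy)))
             (trans eq (colour-external x z (adj⇒≢ G uz))))
  ... | same-last , same-leading with block y ≟F block z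
  ...   | yes same = coordinates-injective y z same
          (L-injective (pos x) (pos y) (pos z) (<⇒≤ (pos< x)) (pos< y) (pos< z) same-last)
  ...   | no different =
          ⊥-elim (IC.proper (block x) (block y) (block z) uy uz different same-leading)

  proper : ∀ x y z → Adj H x y → Adj H x z → y ≢ z → colour x y ≢ colour x z
  proper x y z xy xz y≢z eq with adjacent-split x y xy | adjacent-split x z xz
  ... | inj₂ (same-y , differ-y) | inj₂ (same-z , differ-z) =
    y≢z (internal-proper x y z same-y same-z differ-y differ-z eq)
  ... | inj₁ uy           | inj₁ uz           = y≢z (external-proper x y z uy uz eq)
  ... | inj₂ (same , _)   | inj₁ uz           = internal≢external x y z same uz eq
  ... | inj₁ uy           | inj₂ (same , _)   = internal≢external x z y same uy (sym eq)

  symmetric : ∀ x y → Adj H x y → colour x y ≡ colour y x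
  symmetric x y xy with adjacent-split x y xy
  ... | inj₁ uv = begin
    colour x y                                    ≡⟨ colour-external x y (adj⇒≢ G uv) ⟩
    L (pos x) (pos y) + c (block x) (block y) * N ≡⟨ cong₂ (λ l e → l + e * N) (L-sym (pos x) (pos y))
                                                                         (IC.symmetric _ _ uv) ⟩
    L (pos y) (pos x) + c (block y) (block x) * N ≡⟨ colour-external y x (λ eq → adj⇒≢ G uv (sym eq)) ⟨
    colour y x                                    ∎
    where open ≡-Reasoning
  ... | inj₂ (same , _) = begin
    colour x y                            ≡⟨ colour-internal x y same ⟩
    β (block x) + suc (φ (pos x) (pos y)) ≡⟨ cong₂ (λ u f → β u + suc f) same (φ-sym (pos x) (pos y)) ⟩
    β (block y) + suc (φ (pos y) (pos x)) ≡⟨ colour-internal y x (sym same) ⟨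
    colour y x                            ∎
    where open ≡-Reasoning

  offset-room : ∀ T → M + t * N ≤ T → (∀ u → below u ≡ false → M + t * N + M ≤ T) →
                ∀ u → β u + M ≤ T
  offset-room T room room-above u with span u | below u in below≡
  ... | isolated _          | _     = ≤-trans (m≤m+n M (t * N)) room
  ... | spans p h p<h h≤t _ | true  =
    ≤-trans (≤-reflexive (+-comm (p * N) M))
      (≤-trans (+-monoʳ-≤ M (*-monoˡ-≤ N (≤-trans (<⇒≤ p<h) h≤t))) room)
  ... | spans p h _ h≤t _   | false =
    ≤-trans (+-monoˡ-≤ M (+-monoʳ-≤ M (*-monoˡ-≤ N h≤t))) (room-above u below≡)

  interval-coloring : ∀ T → M + t * N ≤ T → (∀ u → β u + M ≤ T) →
    (∀ k → 1 ≤ k → k ≤ T → ∃[ x ] ∃[ y ] (Adj H x y × colour x y ≡ k)) →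
    HasIntervalColoring H T
  interval-coloring T room internal-room all-used = colour , record
    { symmetric = symmetric
    ; inRange   = inRange
    ; allUsed   = all-used
    ; proper    = proper
    ; interval  = λ x → let lo , hi , ex = interval-at x in lo , hi , exactly⇒interval ex
    }
    where
    inRange : ∀ x y → Adj H x y → 1 ≤ colour x y × colour x y ≤ T
    inRange x y xy with adjacent-split x y xy
    ... | inj₂ (same , _) =
      ≤-trans (s≤s z≤n) (proj₁ (internal-range x y same)) ,
      ≤-trans (proj₂ (internal-range x y same)) (internal-room (block x))
    ... | inj₁ uv with span (block x)
    ...   | isolated iso          = ⊥-elim (iso _ uv)
    ...   | spans p h _ h≤t ex =
      ≤-trans (s≤s z≤n) (proj₁ (external-range x y ex uv)) ,
      ≤-trans (proj₂ (external-range x y ex uv)) (≤-trans (+-monoʳ-≤ M (*-monoˡ-≤ N h≤t)) room)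

  -- Every colour N, …, M + tN is used on an external edge, since c uses 1, …, t:
  -- k is the colour of (u,0)(v, k mod N) for an edge uv of colour k / N.
  external-used : ∀ k → N ≤ k → k ≤ M + t * N → ∃[ x ] ∃[ y ] (Adj H x y × colour x y ≡ k)
  external-used k N≤k k≤top
    with leading-digit 0 t k (subst (_≤ k) (sym (*-identityˡ N)) N≤k) k≤top
  ... | 1≤k/N , k/N≤t with IC.allUsed (k / N) 1≤k/N k/N≤t
  ...   | u , v , uv , c≡k/N =
    x , y , adjacent-external x y (subst₂ (Adj G) (sym block-x) (sym block-y) uv) , (begin
      colour x y                                    ≡⟨ colour-external x y different ⟩
      L (pos x) (pos y) + c (block x) (block y) * N ≡⟨ cong₂ (λ l e → l + e * N) (cong₂ L pos-x pos-y)
                                                                                (cong₂ c block-x block-y) ⟩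
      (k % N) % N + c u v * N                       ≡⟨ cong₂ (λ l e → l + e * N) (m%n%n≡m%n k N) c≡k/N ⟩
      k % N + k / N * N                             ≡⟨ m≡m%n+[m/n]*n k N ⟨
      k                                             ∎)
    where
    open ≡-Reasoning
    x y : X
    x = pair u 0 (s≤s z≤n)
    y = pair v (k % N) (m%n<n k N)
    block-x : block x ≡ u
    block-x = block-pair u 0 (s≤s z≤n)
    block-y : block y ≡ v
    block-y = block-pair v (k % N) (m%n<n k N)
    pos-x : pos x ≡ 0
    pos-x = pos-pair u 0 (s≤s z≤n)
    pos-y : pos y ≡ k % N
    pos-y = pos-pair v (k % N) (m%n<n k N)
    different : block x ≢ block y
    different eq = adj⇒≢ G uv (trans (sym block-x) (trans eq block-y))

  internal-used : ∀ u {b} → β u ≡ b → ∀ k → b < k → k ≤ b + M →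
                  ∃[ x ] ∃[ y ] (Adj H x y × colour x y ≡ k)
  internal-used u {b} β≡b k b<k k≤top = x , internal-realised x k
    (subst (_< k) (sym β-x) b<k) (subst (λ e → k ≤ e + M) (sym β-x) k≤top)
    where
    x : X
    x = pair u 0 (s≤s z≤n)
    β-x : β (block x) ≡ b
    β-x = trans (cong β (block-pair u 0 (s≤s z≤n))) β≡b

  β-bottom : ∀ u v → Adj G u v → c u v ≡ 1 → below u ≡ true → β u ≡ 0
  β-bottom u v uv c≡1 below≡ rewrite below≡ with span u
  ... | isolated iso = ⊥-elim (iso v uv)
  ... | spans zero    _ _ _ _  = refl
  ... | spans (suc p) _ _ _ ex with ≤-trans (proj₁ (Exactly.bounded ex v uv)) (≤-reflexive c≡1)
  ...   | s≤s ()

  β-top : ∀ u v → Adj G u v → c u v ≡ t → below u ≡ false → β u ≡ M + t * N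
  β-top u v uv c≡t below≡ rewrite below≡ with span u
  ... | isolated iso = ⊥-elim (iso v uv)
  ... | spans p h _ h≤t ex =
    cong (λ e → M + e * N) (≤-antisym h≤t (subst (_≤ h) c≡t (proj₂ (Exactly.bounded ex v uv))))

coloured-edge-avoiding : ∀ {G t c} → IsIntervalColoring G t c → ∀ u₀ u v k →
  Adj G u v → c u v ≡ k → ∃[ z ] ∃[ w ] (Adj G z w × c z w ≡ k × z ≢ u₀)
coloured-edge-avoiding {G} IC u₀ u v k uv c≡k with u ≟F u₀
... | no u≢u₀ = u , v , uv , c≡k , u≢u₀
... | yes refl = v , u , trans (adjSym G v u) uv ,
                 trans (sym (IsIntervalColoring.symmetric IC u v uv)) c≡k ,
                 (λ v≡u → adj⇒≢ G uv (sym v≡u))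

module Constructions {G : Graph} {t : ℕ} {c : Fin (order G) → Fin (order G) → ℕ}
                     (IC : IsIntervalColoring G t c) (1≤t : 1 ≤ t) (n′ : ℕ) where

  open RoundRobin n′ using (M)
  private module IC = IsIntervalColoring IC

  N : ℕ
  N = suc M

  -- All blocks below: colours 1, …, M inside the block over u₁, then the external
  -- colours N, …, M + tN.
  all-below : HasIntervalColoring (G [ K N ]) (M + t * N)
  all-below with IC.allUsed 1 ≤-refl 1≤t
  ... | u₁ , v₁ , u₁v₁ , c₁ =
    interval-coloring (M + t * N) ≤-refl (offset-room _ ≤-refl (λ _ ())) used
    where
    open Lift IC n′ (λ _ → true) hiding (N)
    used : ∀ k → 1 ≤ k → k ≤ M + t * N → ∃[ x ] ∃[ y ] (Adj (G [ K N ]) x y × colour x y ≡ k)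
    used k 1≤k k≤T with k ≤? M
    ... | yes k≤M = internal-used u₁ (β-bottom u₁ v₁ u₁v₁ c₁ refl) k 1≤k k≤M
    ... | no  k≰M = external-used k (≰⇒> k≰M) k≤T

  -- Only the block over u₁ below: as before, plus the colours M + tN + 1, …, M + tN + M
  -- inside the block over the end z ≠ u₁ of a colour-t edge.
  one-below : HasIntervalColoring (G [ K N ]) (M + t * N + M)
  one-below with IC.allUsed 1 ≤-refl 1≤t | IC.allUsed t 1≤t ≤-refl
  ... | u₁ , v₁ , u₁v₁ , c₁ | u , v , uv , c≡t
    with coloured-edge-avoiding IC u₁ u v t uv c≡t
  ...   | z , w , zw , cₜ , z≢u₁ =
    interval-coloring (M + t * N + M) (m≤m+n _ M) (offset-room _ (m≤m+n _ M) (λ _ _ → ≤-refl)) used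
    where
    at-u₁ : Fin (order G) → Bool
    at-u₁ x = does (x ≟F u₁)
    open Lift IC n′ at-u₁ hiding (N)
    β₁≡0 : β u₁ ≡ 0
    β₁≡0 = β-bottom u₁ v₁ u₁v₁ c₁ (dec-true (u₁ ≟F u₁) refl)
    βz≡top : β z ≡ M + t * N
    βz≡top = β-top z w zw cₜ (dec-false (z ≟F u₁) z≢u₁)
    used : ∀ k → 1 ≤ k → k ≤ M + t * N + M → ∃[ x ] ∃[ y ] (Adj (G [ K N ]) x y × colour x y ≡ k)
    used k 1≤k k≤T with k ≤? M | k ≤? M + t * N
    ... | yes k≤M | _         = internal-used u₁ β₁≡0 k 1≤k k≤M
    ... | no  k≰M | yes k≤top = external-used k (≰⇒> k≰M) k≤top
    ... | no  _   | no  k≰top = internal-used z βz≡top k (≰⇒> k≰top) k≤T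

-- The colour counts M + wN and M + WN + M against the bounds of the theorem, for
-- n = n′ + 1, M = 2n′ + 1 and N = 2n′ + 2.
count-all-below : ∀ w n′ → (2 * w + 2) * suc n′ ≡ suc (suc (n′ + n′) + w * suc (suc (n′ + n′)))
count-all-below = solve-∀

count-one-below : ∀ W n′ →
  (2 * W + 3) * suc n′ ≡ suc (suc (suc (n′ + n′) + W * suc (suc (n′ + n′)) + n′))
count-one-below = solve-∀

N≡2n : ∀ n′ → suc (suc (n′ + n′)) ≡ 2 * suc n′
N≡2n = solve-∀

theorem7 : (G : Graph) → IntervalColorable G →
    (n : ℕ) → 1 ≤ n →
      IntervalColorable (G [ K (2 * n) ])
      × (∀ w w′ → IsW G w → IsW (G [ K (2 * n) ]) w′ →
           w′ ≤ (2 * w + 2) * n ∸ 1)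
      × (∀ W W′ → IsWmax G W → IsWmax (G [ K (2 * n) ]) W′ →
           (2 * W + 3) * n ∸ 2 ≤ W′)
theorem7 G (t , 1≤t , c , IC) (suc n′) _ = colourable , w-bound , W-bound
  where
  open RoundRobin n′ using (M)
  open Constructions using (all-below; one-below)
  N : ℕ
  N = suc M
  transport : ∀ {T} → HasIntervalColoring (G [ K N ]) T → HasIntervalColoring (G [ K (2 * suc n′) ]) T
  transport {T} = subst (λ m → HasIntervalColoring (G [ K m ]) T) (N≡2n n′)
  colourable : IntervalColorable (G [ K (2 * suc n′) ])
  colourable = M + t * N , s≤s z≤n , transport (all-below IC 1≤t n′)
  w-bound : ∀ w w′ → IsW G w → IsW (G [ K (2 * suc n′) ]) w′ → w′ ≤ (2 * w + 2) * suc n′ ∸ 1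
  w-bound w w′ ((1≤w , cw , ICw) , _) (_ , least) =
    subst (w′ ≤_) (cong (_∸ 1) (sym (count-all-below w n′)))
      (least _ (s≤s z≤n) (transport (all-below ICw 1≤w n′)))
  W-bound : ∀ W W′ → IsWmax G W → IsWmax (G [ K (2 * suc n′) ]) W′ → (2 * W + 3) * suc n′ ∸ 2 ≤ W′
  W-bound W W′ ((1≤W , cW , ICW) , _) (_ , greatest) = begin
    (2 * W + 3) * suc n′ ∸ 2 ≡⟨ cong (_∸ 2) (count-one-below W n′) ⟩
    M + W * N + n′           ≤⟨ +-monoʳ-≤ (M + W * N) (≤-trans (m≤n+m n′ n′) (n≤1+n _)) ⟩
    M + W * N + M            ≤⟨ greatest _ (s≤s z≤n) (transport (one-below ICW 1≤W n′)) ⟩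
    W′                       ∎
    where open ≤-Reasoning
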